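{- Let $q$ be a prime power and $n,k\ge1$ integers with $k\le q^n$. There exists a set $U\subseteq\mathbb{F}_q^n$ with $$|U|=\big(1-(1-q^{ -\lfloor n/k\rfloor})^k\big)q^n$$ such that for every $k$-element subset $S\subseteq\mathbb{F}_q^n$ there is $b\in\mathbb{F}_q^n$ with $b+S\subseteq U$.
   Context: $\mathbb{F}_q$ denotes the finite field with $q$ elements. -}

module Defs where

open import Data.Nat using (ℕ; _^_; _∸_; _≤_; _/_; NonZero)
import Data.Nat as ℕ
open import Data.Nat.Primality using (Prime)
open import Data.Fin using (Fin)
open import Data.Vec using (Vec; zipWith)
open import Data.Product using (Σ; ∃; _×_)
open import Algebra.Structures using (IsCommutativeRing)
open import Relation.Binary.PropositionalEquality using (_≡_; _≢_)

record FiniteField (q : ℕ) : Set where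
  infixl 6 _+_
  infixl 7 _*_
  field
    _+_ _*_ : Fin q → Fin q → Fin q
    -_      : Fin q → Fin q
    0# 1#   : Fin q
    isCommutativeRing : IsCommutativeRing _≡_ _+_ _*_ -_ 0# 1#
    0≢1     : 0# ≢ 1#
    inverse : ∀ x → x ≢ 0# → ∃ λ y → x * y ≡ 1#

IsPrimePower : ℕ → Set
IsPrimePower q = Σ ℕ λ p → Σ ℕ λ m → Prime p × (1 ≤ m) × (q ≡ p ^ m)

translate : ∀ {q n} → FiniteField q → Vec (Fin q) n → Vec (Fin q) n → Vec (Fin q) n
translate F b v = zipWith (FiniteField._+_ F) b v

-- the target size (1 - (1 - q^{-m})^k) q^n with m = ⌊n/k⌋, written in ℕ as
-- q^n - (q^m - 1)^k * q^(n - m k)   (exact, since m k ≤ n and q ≥ 1)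
targetSize : (q n k : ℕ) → .{{NonZero k}} → ℕ
targetSize q n k = q ^ n ∸ (q ^ (n / k) ∸ 1) ^ k ℕ.* q ^ (n ∸ (n / k) ℕ.* k)

{-# OPTIONS --safe #-}
module Submission where

-- Write n = m k + r with m = ⌊n/k⌋ and cut every vector into k blocks of
-- length m followed by a tail of length r.  Let U be the set of vectors one
-- of whose k blocks is zero.  Its complement consists of the vectors all of
-- whose blocks are nonzero, so it has (q^m − 1)^k q^r elements.  Given
-- s₁, …, s_k, the translation vector b whose i-th block is minus the i-th
-- block of s_i makes the i-th block of b + s_i zero, so b + s_i ∈ U.

open import Defs
open import Level using (0ℓ)
open import Algebra.Core using (Op₁; Op₂)
open import Algebra.Structures using (IsGroup; IsCommutativeRing)
open import Data.Bool using (true; false)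
open import Data.Fin using (Fin)
import Data.Fin.Properties as Fin
open import Data.List using (List; []; _∷_; [_]; _++_; length; map; filter; allFin; cartesianProductWith)
open import Data.List.Membership.Propositional using (_∈_)
open import Data.List.Membership.Propositional.Properties using (∈-allFin; ∈-cartesianProductWith⁺; ∈-filter⁺)
open import Data.List.Properties using (length-map; length-++; length-tabulate; filter-++; filter-accept; filter-reject; filter-all; filter-none; filter-≐; map-cong)
open import Data.List.Relation.Unary.All as All using (All; []; _∷_)
import Data.List.Relation.Unary.All.Properties as All
open import Data.List.Relation.Unary.Any using (here; there)
open import Data.List.Relation.Unary.Unique.Propositional using (Unique; []; _∷_)
import Data.List.Relation.Unary.Unique.Propositional.Properties as Unique
open import Data.Nat using (ℕ; zero; suc; _+_; _*_; _^_; _∸_; _≤_; _/_; s≤s; NonZero)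
open import Data.Nat.DivMod using (m/n*n≤m)
open import Data.Nat.ListAction using (sum)
open import Data.Nat.Properties using (+-suc; +-assoc; +-identityʳ; *-zeroʳ; *-suc; *-identityˡ; *-assoc; *-distribʳ-+; m+[n∸m]≡n; m+n∸m≡n; ≤-reflexive)
open import Data.Product using (Σ; ∃; _×_; _,_; proj₁; proj₂)
open import Data.Unit using (⊤; tt)
open import Data.Vec as Vec using (Vec; []; _∷_; take; drop; replicate; zipWith)
import Data.Vec.Properties as Vecₚ
open import Function using (_∘_; id)
open import Relation.Binary.Definitions using (DecidableEquality)
open import Relation.Binary.PropositionalEquality using (_≡_; _≢_; refl; sym; trans; cong; cong₂; subst; ≢-sym; module ≡-Reasoning)
open import Relation.Nullary using (yes; no; does; ¬?; _×-dec_)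
open import Relation.Unary using (Pred; Decidable; ∁)
open import Relation.Unary.Properties using (∁?)

module _ {a p} {A : Set a} {P : Pred A p} (P? : Decidable P) where

  length-filter-∁ : ∀ xs → length (filter P? xs) + length (filter (∁? P?) xs) ≡ length xs
  length-filter-∁ []       = refl
  length-filter-∁ (x ∷ xs) with does (P? x)
  ... | true  = cong suc (length-filter-∁ xs)
  ... | false = trans (+-suc _ _) (cong suc (length-filter-∁ xs))

  filter-map : ∀ {b} {B : Set b} (f : B → A) xs → filter P? (map f xs) ≡ map f (filter (P? ∘ f) xs)
  filter-map f []       = refl
  filter-map f (x ∷ xs) with does (P? (f x))
  ... | true  = cong (f x ∷_) (filter-map f xs)
  ... | false = filter-map f xs

  length-filter-cartesianProductWith : ∀ {b c} {B : Set b} {C : Set c} (f : B → C → A) xs ys →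
    length (filter P? (cartesianProductWith f xs ys)) ≡ sum (map (λ x → length (filter (P? ∘ f x) ys)) xs)
  length-filter-cartesianProductWith f []       ys = refl
  length-filter-cartesianProductWith f (x ∷ xs) ys = begin
    length (filter P? (map (f x) ys ++ cartesianProductWith f xs ys))
      ≡⟨ cong length (filter-++ P? (map (f x) ys) _) ⟩
    length (filter P? (map (f x) ys) ++ filter P? (cartesianProductWith f xs ys))
      ≡⟨ length-++ (filter P? (map (f x) ys)) ⟩
    length (filter P? (map (f x) ys)) + length (filter P? (cartesianProductWith f xs ys))
      ≡⟨ cong₂ _+_ (trans (cong length (filter-map (f x) ys)) (length-map (f x) (filter (P? ∘ f x) ys)))
                   (length-filter-cartesianProductWith f xs ys) ⟩
    length (filter (P? ∘ f x) ys) + sum (map (λ x → length (filter (P? ∘ f x) ys)) xs) ∎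
    where open ≡-Reasoning

length-filter-≟-unique : ∀ {a} {A : Set a} (_≟_ : DecidableEquality A) {x : A} {xs} →
  Unique xs → x ∈ xs → length (filter (_≟ x) xs) ≡ 1
length-filter-≟-unique _≟_ {x} (x≢xs ∷ _) (here refl) =
  trans (cong length (filter-accept (_≟ x) refl))
        (cong (suc ∘ length) (filter-none (_≟ x) (All.map ≢-sym x≢xs)))
length-filter-≟-unique _≟_ {x} (y≢xs ∷ xs!) (there x∈xs) =
  trans (cong length (filter-reject (_≟ x) λ { refl → All.lookup y≢xs x∈xs refl }))
        (length-filter-≟-unique _≟_ xs! x∈xs)

sum-map-*ʳ : ∀ {a} {A : Set a} (f : A → ℕ) c xs → sum (map (λ x → f x * c) xs) ≡ sum (map f xs) * c
sum-map-*ʳ f c []       = refl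
sum-map-*ʳ f c (x ∷ xs) = trans (cong (f x * c +_) (sum-map-*ʳ f c xs)) (sym (*-distribʳ-+ c (f x) _))

length-cartesianProductWith : ∀ {a b c} {A : Set a} {B : Set b} {C : Set c} (f : A → B → C) xs ys →
  length (cartesianProductWith f xs ys) ≡ length xs * length ys
length-cartesianProductWith f []       ys = refl
length-cartesianProductWith f (x ∷ xs) ys = begin
  length (map (f x) ys ++ cartesianProductWith f xs ys)  ≡⟨ length-++ (map (f x) ys) ⟩
  length (map (f x) ys) + length (cartesianProductWith f xs ys)
    ≡⟨ cong₂ _+_ (length-map (f x) ys) (length-cartesianProductWith f xs ys) ⟩
  length ys + length xs * length ys                        ∎
  where open ≡-Reasoning

module _ {a} {A : Set a} {m n : ℕ} (u : Vec A m) (v : Vec A n) where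

  take-++ : take m (u Vec.++ v) ≡ u
  take-++ = Vecₚ.++-injectiveˡ _ u (Vecₚ.take++drop≡id m (u Vec.++ v))

  drop-++ : drop m (u Vec.++ v) ≡ v
  drop-++ = Vecₚ.++-injectiveʳ _ u (Vecₚ.take++drop≡id m (u Vec.++ v))

-- Nested to the right, so that take m and drop m split off one block definitionally.
blocks : (m r k : ℕ) → ℕ
blocks m r zero    = r
blocks m r (suc k) = m + blocks m r k

blocks≡*+ : ∀ m r k → blocks m r k ≡ m * k + r
blocks≡*+ m r zero    = cong (_+ r) (sym (*-zeroʳ m))
blocks≡*+ m r (suc k) = begin
  m + blocks m r k   ≡⟨ cong (m +_) (blocks≡*+ m r k) ⟩
  m + (m * k + r)    ≡⟨ +-assoc m (m * k) r ⟨
  m + m * k + r      ≡⟨ cong (_+ r) (*-suc m k) ⟨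
  m * suc k + r      ∎
  where open ≡-Reasoning

blocks-∸ : ∀ m k {n} → m * k ≤ n → blocks m (n ∸ m * k) k ≡ n
blocks-∸ m k {n} mk≤n = trans (blocks≡*+ m (n ∸ m * k) k) (m+[n∸m]≡n mk≤n)

module _ {A : Set} {m : ℕ} (w : Vec A m) (r : ℕ) where

  EveryBlock≢ : ∀ k → Pred (Vec A (blocks m r k)) 0ℓ
  EveryBlock≢ zero    _ = ⊤
  EveryBlock≢ (suc k) v = take m v ≢ w × EveryBlock≢ k (drop m v)

  everyBlock≢? : DecidableEquality A → ∀ k → Decidable (EveryBlock≢ k)
  everyBlock≢? _≟_ zero    _ = yes tt
  everyBlock≢? _≟_ (suc k) v = ¬? (Vecₚ.≡-dec _≟_ (take m v) w) ×-dec everyBlock≢? _≟_ k (drop m v)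

module Counting (q : ℕ) where

  vecs : ∀ n → List (Vec (Fin q) n)
  vecs zero    = [ [] ]
  vecs (suc n) = cartesianProductWith _∷_ (allFin q) (vecs n)

  vecs-unique : ∀ n → Unique (vecs n)
  vecs-unique zero    = [] ∷ []
  vecs-unique (suc n) =
    Unique.cartesianProductWith⁺ _∷_ Vecₚ.∷-injective (Unique.allFin⁺ q) (vecs-unique n)

  ∈-vecs : ∀ {n} (v : Vec (Fin q) n) → v ∈ vecs n
  ∈-vecs []      = here refl
  ∈-vecs (x ∷ v) = ∈-cartesianProductWith⁺ _∷_ (∈-allFin x) (∈-vecs v)

  length-vecs : ∀ n → length (vecs n) ≡ q ^ n
  length-vecs zero    = refl
  length-vecs (suc n) = begin
    length (cartesianProductWith _∷_ (allFin q) (vecs n))  ≡⟨ length-cartesianProductWith _∷_ (allFin q) (vecs n) ⟩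
    length (allFin q) * length (vecs n)                    ≡⟨ cong₂ _*_ (length-tabulate {n = q} id) (length-vecs n) ⟩
    q * q ^ n                                              ∎
    where open ≡-Reasoning

  _≟_ : ∀ {n} → DecidableEquality (Vec (Fin q) n)
  _≟_ = Vecₚ.≡-dec Fin._≟_

  count : ∀ {n p} {P : Pred (Vec (Fin q) n) p} → Decidable P → ℕ
  count {n} P? = length (filter P? (vecs n))

  module _ {n p} {P : Pred (Vec (Fin q) n) p} (P? : Decidable P) where

    count-universal : (∀ v → P v) → count P? ≡ q ^ n
    count-universal all = trans (cong length (filter-all P? (All.universal all (vecs n)))) (length-vecs n)

    count-∁ : count P? + count (∁? P?) ≡ q ^ n
    count-∁ = trans (length-filter-∁ P? (vecs n)) (length-vecs n)

  count-∷ : ∀ {n p} {P : Pred (Vec (Fin q) (suc n)) p} (P? : Decidable P) →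
            count P? ≡ sum (map (λ x → count (P? ∘ (x ∷_))) (allFin q))
  count-∷ P? = length-filter-cartesianProductWith P? _∷_ (allFin q) (vecs _)

  count-≡ : ∀ {n} (w : Vec (Fin q) n) → count (_≟ w) ≡ 1
  count-≡ {n} w = length-filter-≟-unique _≟_ (vecs-unique n) (∈-vecs w)

  count-≢ : ∀ {n} (w : Vec (Fin q) n) → count (∁? (_≟ w)) ≡ q ^ n ∸ 1
  count-≢ {n} w = begin
    count (∁? (_≟ w))                      ≡⟨ m+n∸m≡n 1 (count (∁? (_≟ w))) ⟨
    1 + count (∁? (_≟ w)) ∸ 1              ≡⟨ cong (λ c → c + count (∁? (_≟ w)) ∸ 1) (count-≡ w) ⟨
    count (_≟ w) + count (∁? (_≟ w)) ∸ 1   ≡⟨ cong (_∸ 1) (count-∁ (_≟ w)) ⟩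
    q ^ n ∸ 1                              ∎
    where open ≡-Reasoning

  count-take-drop : ∀ a {b p₁ p₂} {P : Pred (Vec (Fin q) a) p₁} {Q : Pred (Vec (Fin q) b) p₂}
                    (P? : Decidable P) (Q? : Decidable Q) →
                    count (λ v → P? (take a v) ×-dec Q? (drop a v)) ≡ count P? * count Q?
  count-take-drop zero P? Q? with P? []
  ... | yes p = trans (cong length (filter-≐ (λ v → yes p ×-dec Q? v) Q? (proj₂ , (p ,_)) (vecs _)))
                      (sym (+-identityʳ _))
  ... | no ¬p = cong length (filter-none (λ v → no ¬p ×-dec Q? v)
                                         (All.universal (λ _ → ¬p ∘ proj₁) (vecs _)))
  count-take-drop (suc a) P? Q? = begin
    count R?                                                      ≡⟨ count-∷ R? ⟩
    sum (map (λ x → count (R? ∘ (x ∷_))) (allFin q))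
      ≡⟨ cong sum (map-cong (λ x → count-take-drop a (P? ∘ (x ∷_)) Q?) (allFin q)) ⟩
    sum (map (λ x → count (P? ∘ (x ∷_)) * count Q?) (allFin q))  ≡⟨ sum-map-*ʳ _ (count Q?) (allFin q) ⟩
    sum (map (λ x → count (P? ∘ (x ∷_))) (allFin q)) * count Q?  ≡⟨ cong (_* count Q?) (count-∷ P?) ⟨
    count P? * count Q?                                           ∎
    where
    open ≡-Reasoning
    R? = λ v → P? (take (suc a) v) ×-dec Q? (drop (suc a) v)

  count-everyBlock≢ : ∀ {m} (w : Vec (Fin q) m) r k →
                      count (everyBlock≢? w r Fin._≟_ k) ≡ (q ^ m ∸ 1) ^ k * q ^ r
  count-everyBlock≢ w r zero    =
    trans (count-universal (everyBlock≢? w r Fin._≟_ zero) (λ _ → tt)) (sym (*-identityˡ _))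
  count-everyBlock≢ {m} w r (suc k) = begin
    count (everyBlock≢? w r Fin._≟_ (suc k))
      ≡⟨ count-take-drop m (∁? (_≟ w)) (everyBlock≢? w r Fin._≟_ k) ⟩
    count (∁? (_≟ w)) * count (everyBlock≢? w r Fin._≟_ k)
      ≡⟨ cong₂ _*_ (count-≢ w) (count-everyBlock≢ w r k) ⟩
    (q ^ m ∸ 1) * ((q ^ m ∸ 1) ^ k * q ^ r)  ≡⟨ *-assoc (q ^ m ∸ 1) _ _ ⟨
    (q ^ m ∸ 1) ^ suc k * q ^ r               ∎
    where open ≡-Reasoning

module Covering {q} {_∙_ : Op₂ (Fin q)} {ε : Fin q} {_⁻¹ : Op₁ (Fin q)}
                (isGroup : IsGroup _≡_ _∙_ ε _⁻¹) (m r : ℕ) where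

  open Counting q
  open IsGroup isGroup using (inverseˡ)

  ε̄ : Vec (Fin q) m
  ε̄ = replicate m ε

  SomeBlock≡ε̄ : ∀ k → Pred (Vec (Fin q) (blocks m r k)) 0ℓ
  SomeBlock≡ε̄ k = ∁ (EveryBlock≢ ε̄ r k)

  someBlock≡ε̄? : ∀ k → Decidable (SomeBlock≡ε̄ k)
  someBlock≡ε̄? k = ∁? (everyBlock≢? ε̄ r Fin._≟_ k)

  translate-someBlock≡ε̄ : ∀ k (S : List (Vec (Fin q) (blocks m r k))) → length S ≤ k →
                          ∃ λ b → All (SomeBlock≡ε̄ k ∘ zipWith _∙_ b) S
  translate-someBlock≡ε̄ k       []      _           = replicate _ ε , []
  translate-someBlock≡ε̄ (suc k) (s ∷ S) (s≤s |S|≤k)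
    with b₂ , hits ← translate-someBlock≡ε̄ k (map (drop m) S)
                       (subst (_≤ k) (sym (length-map (drop m) S)) |S|≤k)
    = b₁ Vec.++ b₂ , hit-s ∷ All.map hit-t (All.map⁻ hits)
    where
    b₁ : Vec (Fin q) m
    b₁ = Vec.map _⁻¹ (take m s)

    hit-s : SomeBlock≡ε̄ (suc k) (zipWith _∙_ (b₁ Vec.++ b₂) s)
    hit-s (first≢ε̄ , _) = first≢ε̄ (begin
      take m (zipWith _∙_ (b₁ Vec.++ b₂) s)           ≡⟨ Vecₚ.take-zipWith _∙_ (b₁ Vec.++ b₂) s ⟩
      zipWith _∙_ (take m (b₁ Vec.++ b₂)) (take m s)  ≡⟨ cong (λ u → zipWith _∙_ u (take m s)) (take-++ b₁ b₂) ⟩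
      zipWith _∙_ b₁ (take m s)                       ≡⟨ Vecₚ.zipWith-inverseˡ inverseˡ (take m s) ⟩
      ε̄                                               ∎)
      where open ≡-Reasoning

    hit-t : ∀ {t} → SomeBlock≡ε̄ k (zipWith _∙_ b₂ (drop m t)) →
            SomeBlock≡ε̄ (suc k) (zipWith _∙_ (b₁ Vec.++ b₂) t)
    hit-t {t} ¬rest (_ , rest) = ¬rest (subst (EveryBlock≢ ε̄ r k) drop-b+t rest)
      where
      drop-b+t : drop m (zipWith _∙_ (b₁ Vec.++ b₂) t) ≡ zipWith _∙_ b₂ (drop m t)
      drop-b+t = trans (Vecₚ.drop-zipWith _∙_ (b₁ Vec.++ b₂) t)
                       (cong (λ u → zipWith _∙_ u (drop m t)) (drop-++ b₁ b₂))

  TranslateCover : ∀ {n} → ℕ → List (Vec (Fin q) n) → Set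
  TranslateCover k U = ∀ S → length S ≤ k → ∃ λ b → All (λ s → zipWith _∙_ b s ∈ U) S

  translateCover : ∀ k {n} → blocks m r k ≡ n →
    Σ (List (Vec (Fin q) n)) λ U →
      Unique U × length U ≡ q ^ n ∸ (q ^ m ∸ 1) ^ k * q ^ r × TranslateCover k U
  translateCover k refl = U , Unique.filter⁺ (someBlock≡ε̄? k) (vecs-unique _) , length-U , cover
    where
    U = filter (someBlock≡ε̄? k) (vecs _)

    length-U : length U ≡ q ^ blocks m r k ∸ (q ^ m ∸ 1) ^ k * q ^ r
    length-U = begin
      count (someBlock≡ε̄? k)                                          ≡⟨ m+n∸m≡n (count P?) _ ⟨
      count P? + count (someBlock≡ε̄? k) ∸ count P?                    ≡⟨ cong₂ _∸_ (count-∁ P?) (count-everyBlock≢ ε̄ r k) ⟩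
      q ^ blocks m r k ∸ (q ^ m ∸ 1) ^ k * q ^ r                      ∎
      where
      open ≡-Reasoning
      P? = everyBlock≢? ε̄ r Fin._≟_ k

    cover : TranslateCover k U
    cover S |S|≤k = let b , hits = translate-someBlock≡ε̄ k S |S|≤k
                    in b , All.map (∈-filter⁺ (someBlock≡ε̄? k) (∈-vecs _)) hits

lemma2 : (q : ℕ) → IsPrimePower q → (F : FiniteField q) →
         (n k : ℕ) → 1 ≤ n → .{{_ : NonZero k}} → k ≤ q ^ n →
         Σ (List (Vec (Fin q) n)) λ U →
           Unique U × (length U ≡ targetSize q n k) ×
           ((S : List (Vec (Fin q) n)) → Unique S → length S ≡ k →
             ∃ λ (b : Vec (Fin q) n) → All (λ s → translate F b s ∈ U) S)
lemma2 q _ F n k _ _ =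
  let U , U! , |U| , cover = translateCover k (blocks-∸ m k (m/n*n≤m n k))
  in U , U! , |U| , λ S _ |S|≡k → cover S (≤-reflexive |S|≡k)
  where
  open IsCommutativeRing (FiniteField.isCommutativeRing F) using (+-isGroup)
  m = n / k
  open Covering +-isGroup m (n ∸ m * k) using (translateCover)
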